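{- Let $G=(V,E)$ and $G'=(V',E')$ be finite, simple, connected graphs such that $G'$ is a subgraph of $G$. Let $T$ be a solution of the MSTCI problem for $G$, and suppose that $T'=T\cap G'$ (the intersection taken as subgraphs of $G$) is a spanning tree of $G'$. Then $\cap(G')\le\cap(G)$.
   Context: For a spanning tree $T$ of a graph $H$, edges of $T$ are tree-edges and edges of $H$ not in $T$ are cycle-edges; a cycle-edge $f=(x,y)$ determines the tree-cycle formed by the unique $x$–$y$ path in $T$ together with $f$. $\cap_H(T)$ is the number of unordered pairs of distinct cycle-edges whose tree-cycles share at least one edge. The MSTCI problem for $H$ asks for a spanning tree minimizing $\cap_H(T)$; such a tree is a solution, and $\cap(H)$ denotes the minimum value. -}

module Defs where

open import Data.Nat using (ℕ; _<_; _≤_)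
open import Data.Fin using (Fin; toℕ)
open import Data.Bool using (Bool; true; false; _∧_)
open import Data.Bool.Properties using (∧-comm)
open import Data.List using (List; []; _∷_; length)
open import Data.List.Relation.Unary.Unique.Propositional using (Unique)
open import Data.List.Membership.Propositional using (_∈_)
open import Data.Product using (Σ; ∃; _×_; _,_; proj₁; proj₂)
open import Data.Sum using (_⊎_)
open import Data.Empty using (⊥)
open import Relation.Nullary using (¬_)
open import Relation.Binary.PropositionalEquality using (_≡_; refl; cong₂; trans)
open import Function.Bundles using (_⇔_)

record Graph (n : ℕ) : Set where
  field
    V    : Fin n → Bool
    E    : Fin n → Fin n → Bool
    sym  : ∀ x y → E x y ≡ E y x
    irr  : ∀ x → E x x ≡ false
    inVˡ : ∀ x y → E x y ≡ true → V x ≡ true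

open Graph public

data Walk {n : ℕ} (E : Fin n → Fin n → Bool) : Fin n → Fin n → Set where
  []  : ∀ {x} → Walk E x x
  _∷_ : ∀ {x y z} → E x y ≡ true → Walk E y z → Walk E x z

verts : ∀ {n} {E : Fin n → Fin n → Bool} {x y} → Walk E x y → List (Fin n)
verts {x = x} []       = x ∷ []
verts {x = x} (_ ∷ w)  = x ∷ verts w

len : ∀ {n} {E : Fin n → Fin n → Bool} {x y} → Walk E x y → ℕ
len []      = 0
len (_ ∷ w) = Data.Nat.suc (len w)
  where import Data.Nat

Path : ∀ {n} (E : Fin n → Fin n → Bool) → Fin n → Fin n → Set
Path E x y = Σ (Walk E x y) λ w → Unique (verts w)

SameEdge : ∀ {n} → Fin n → Fin n → Fin n → Fin n → Set
SameEdge a b x y = (a ≡ x × b ≡ y) ⊎ (a ≡ y × b ≡ x)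

EdgeOn : ∀ {n} {E : Fin n → Fin n → Bool} {x y} → Walk E x y → Fin n → Fin n → Set
EdgeOn []                  a b = ⊥
EdgeOn {x = x} (_∷_ {y = y} _ w) a b = SameEdge a b x y ⊎ EdgeOn w a b

Connected : ∀ {n} → Graph n → Set
Connected H = ∀ x y → V H x ≡ true → V H y ≡ true → Walk (E H) x y

-- A cycle: distinct vertices x, y, ..., back to x, with at least 3 edges.
Cycle : ∀ {n} → Graph n → Set
Cycle {n} H = Σ (Fin n) λ x → Σ (Fin n) λ y →
  (E H x y ≡ true) × Σ (Path (E H) y x) λ p → 2 ≤ len (proj₁ p)

Acyclic : ∀ {n} → Graph n → Set
Acyclic H = ¬ Cycle H

Subgraph : ∀ {n} → Graph n → Graph n → Set
Subgraph H G = (∀ x → V H x ≡ true → V G x ≡ true)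
             × (∀ x y → E H x y ≡ true → E G x y ≡ true)

SpanningTree : ∀ {n} → Graph n → Graph n → Set
SpanningTree T H = (∀ x → V T x ≡ V H x)
                 × (∀ x y → E T x y ≡ true → E H x y ≡ true)
                 × Connected T × Acyclic T

∧-false : ∀ b c → b ≡ false → (b ∧ c) ≡ false
∧-false .false c refl = refl

∧-true₁ : ∀ b c → (b ∧ c) ≡ true → b ≡ true
∧-true₁ true  c _ = refl
∧-true₁ false c ()

_∩G_ : ∀ {n} → Graph n → Graph n → Graph n
T ∩G H = record
  { V    = λ x → V T x ∧ V H x
  ; E    = λ x y → E T x y ∧ E H x y
  ; sym  = λ x y → cong₂ _∧_ (sym T x y) (sym H x y)
  ; irr  = λ x → ∧-false (E T x x) (E H x x) (irr T x)
  ; inVˡ = λ x y p → cong₂ _∧_ (inVˡ T x y (∧-true₁ _ _ p))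
                                (inVˡ H x y (∧-true₁ _ _ (trans (∧-comm (E H x y) (E T x y)) p)))
  }

CycleEdge : ∀ {n} → Graph n → Graph n → Fin n → Fin n → Set
CycleEdge H T x y = (E H x y ≡ true) × (E T x y ≡ false)

InTreeCycle : ∀ {n} → Graph n → Fin n → Fin n → Fin n → Fin n → Set
InTreeCycle T x y a b = SameEdge a b x y ⊎ Σ (Path (E T) x y) λ p → EdgeOn (proj₁ p) a b

-- Quadruples (x,y,u,v) encode unordered pairs of distinct edges
-- {x,y} ≠ {u,v} canonically: toℕ x < toℕ y, toℕ u < toℕ v and
-- (x,y) lexicographically smaller than (u,v).
Quad : ℕ → Set
Quad n = Fin n × Fin n × Fin n × Fin n

LexLt : ∀ {n} → Fin n → Fin n → Fin n → Fin n → Set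
LexLt x y u v = (toℕ x < toℕ u) ⊎ (x ≡ u × toℕ y < toℕ v)

IntersectingPair : ∀ {n} → Graph n → Graph n → Quad n → Set
IntersectingPair H T (x , y , u , v) =
  (toℕ x < toℕ y) × (toℕ u < toℕ v) × LexLt x y u v
  × CycleEdge H T x y × CycleEdge H T u v
  × Σ _ λ a → Σ _ λ b → InTreeCycle T x y a b × InTreeCycle T u v a b

CountIs : ∀ {A : Set} → (A → Set) → ℕ → Set
CountIs {A} P k = Σ (List A) λ l → Unique l × (∀ q → (q ∈ l) ⇔ P q) × length l ≡ k

CapIs : ∀ {n} → Graph n → Graph n → ℕ → Set
CapIs H T k = CountIs (IntersectingPair H T) k

IsSolution : ∀ {n} → Graph n → Graph n → Set
IsSolution H T = SpanningTree T H × Σ ℕ λ k → CapIs H T k ×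
  (∀ T₂ k₂ → SpanningTree T₂ H → CapIs H T₂ k₂ → k ≤ k₂)

MinCap : ∀ {n} → Graph n → ℕ → Set
MinCap H m = (Σ (Graph _) λ T → SpanningTree T H × CapIs H T m)
           × (∀ T k → SpanningTree T H → CapIs H T k → m ≤ k)

-- Every cycle-edge of G′ with respect to T′ = T ∩ G′ is a cycle-edge of G with
-- respect to T, and every path in T′ is a path in T, so each pair of cycle-edges
-- counted in ∩_{G′}(T′) is also counted in ∩_G(T). Hence
-- ∩(G′) ≤ ∩_{G′}(T′) ≤ ∩_G(T) = ∩(G).
module Submission where

open import Defs
open import Data.Nat using (ℕ; _≤_; _≤?_)
open import Data.Nat.Properties using (≤-trans)
open import Data.Bool using (Bool; true; _∧_)
open import Data.Bool.Properties using (∧-identityʳ)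
open import Data.Fin using (Fin)
import Data.Fin.Properties as Fin
open import Data.List using (List; _∷_; length; filter)
open import Data.List.Properties using (length-filter)
open import Data.List.Relation.Unary.All as All using (All)
open import Data.List.Relation.Unary.Unique.Propositional using (Unique)
open import Data.List.Relation.Unary.Unique.Propositional.Properties using (filter⁺)
open import Data.List.Membership.Propositional using (_∈_)
open import Data.List.Membership.Propositional.Properties using (∈-filter⁺; ∈-filter⁻)
import Data.List.Membership.DecPropositional as DecMembership
open import Data.Product using (Σ; _×_; _,_; proj₁; proj₂)
open import Data.Product.Properties using (≡-dec)
open import Data.Sum using (inj₁; inj₂)
open import Function using (_∘_)
open import Function.Bundles using (_⇔_; mk⇔; Equivalence)
open import Relation.Nullary using (¬_; Dec; yes; no)
open import Relation.Nullary.Decidable using (map′; decidable-stable; ¬¬-excluded-middle)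
open import Relation.Nullary.Negation using (¬¬-map; ¬¬-Monad)
open import Relation.Unary using (Decidable)
open import Relation.Binary.Definitions using (DecidableEquality)
open import Relation.Binary.PropositionalEquality as ≡ using (_≡_; refl; trans; subst; cong)

module _ {n : ℕ} {E₁ E₂ : Fin n → Fin n → Bool}
         (E₁⊆E₂ : ∀ x y → E₁ x y ≡ true → E₂ x y ≡ true) where

  walk-mono : ∀ {x y} → Walk E₁ x y → Walk E₂ x y
  walk-mono []                = []
  walk-mono (_∷_ {x} {y} e w) = E₁⊆E₂ x y e ∷ walk-mono w

  verts-walk-mono : ∀ {x y} (w : Walk E₁ x y) → verts (walk-mono w) ≡ verts w
  verts-walk-mono []       = refl
  verts-walk-mono (e ∷ w) = cong (_ ∷_) (verts-walk-mono w)

  edgeOn-walk-mono : ∀ {x y a b} (w : Walk E₁ x y) → EdgeOn w a b → EdgeOn (walk-mono w) a b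
  edgeOn-walk-mono (e ∷ w) (inj₁ ab≡xy) = inj₁ ab≡xy
  edgeOn-walk-mono (e ∷ w) (inj₂ ab∈w)  = inj₂ (edgeOn-walk-mono w ab∈w)

  path-mono : ∀ {x y} → Path E₁ x y → Path E₂ x y
  path-mono (w , distinct) = walk-mono w , subst Unique (≡.sym (verts-walk-mono w)) distinct

inTreeCycle-mono : ∀ {n} {T₁ T₂ : Graph n} →
  (∀ x y → E T₁ x y ≡ true → E T₂ x y ≡ true) →
  ∀ {x y a b} → InTreeCycle T₁ x y a b → InTreeCycle T₂ x y a b
inTreeCycle-mono T₁⊆T₂ (inj₁ ab≡xy)      = inj₁ ab≡xy
inTreeCycle-mono T₁⊆T₂ (inj₂ (p , ab∈p)) =
  inj₂ (path-mono T₁⊆T₂ p , edgeOn-walk-mono T₁⊆T₂ (proj₁ p) ab∈p)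

module _ {n} (G G′ T : Graph n) (G′⊆G : Subgraph G′ G) where

  cycleEdge-∩ : ∀ {x y} → CycleEdge G′ (T ∩G G′) x y → CycleEdge G T x y
  cycleEdge-∩ {x} {y} (xy∈G′ , xy∉T∩G′) =
    proj₂ G′⊆G x y xy∈G′ ,
    trans (≡.sym (∧-identityʳ (E T x y))) (subst (λ b → E T x y ∧ b ≡ _) xy∈G′ xy∉T∩G′)

  inTreeCycle-∩ : ∀ {x y a b} → InTreeCycle (T ∩G G′) x y a b → InTreeCycle T x y a b
  inTreeCycle-∩ = inTreeCycle-mono {T₁ = T ∩G G′} {T₂ = T} (λ x y → ∧-true₁ _ _)

  intersectingPair-∩ : ∀ q → IntersectingPair G′ (T ∩G G′) q → IntersectingPair G T q
  intersectingPair-∩ _ (x<y , u<v , lex , xy , uv , a , b , ab∈xy , ab∈uv) =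
    x<y , u<v , lex , cycleEdge-∩ xy , cycleEdge-∩ uv ,
    a , b , inTreeCycle-∩ ab∈xy , inTreeCycle-∩ ab∈uv

¬¬-all-dec : ∀ {A : Set} {P : A → Set} (l : List A) → ¬ ¬ All (Dec ∘ P) l
¬¬-all-dec l = All.sequenceM _ ¬¬-Monad (All.universal (λ _ → ¬¬-excluded-middle) l)

module _ {A : Set} (_≟_ : DecidableEquality A) {P : A → Set} where
  open DecMembership _≟_ using (_∈?_)

  dec-within : ∀ {l} → All (Dec ∘ P) l → Decidable (λ x → x ∈ l × P x)
  dec-within {l} decs x with x ∈? l
  ... | yes x∈l = map′ (x∈l ,_) proj₂ (All.lookup decs x∈l)
  ... | no  x∉l = no (x∉l ∘ proj₁)

  -- P need not be decidable, so the filtered list exists only under double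
  -- negation; this suffices for a decidable goal such as an inequality in ℕ.
  ¬¬-countIs-mono : ∀ {Q : A → Set} {k} → CountIs Q k → (∀ {x} → P x → Q x) →
    ¬ ¬ Σ ℕ λ j → CountIs P j × j ≤ k
  ¬¬-countIs-mono (l , unique , l≡Q , refl) P⊆Q = ¬¬-map count (¬¬-all-dec l)
    where
    count : All (Dec ∘ P) l → Σ ℕ λ j → CountIs P j × j ≤ length l
    count decs = length l′ , (l′ , filter⁺ P? unique , l′≡P , refl) , length-filter P? l
      where
      P? : Decidable (λ x → x ∈ l × P x)
      P? = dec-within decs
      l′ : List A
      l′ = filter P? l
      l′≡P : ∀ x → x ∈ l′ ⇔ P x
      l′≡P x = mk⇔ (proj₂ ∘ proj₂ ∘ ∈-filter⁻ P? {xs = l})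
                   (λ px → let x∈l = Equivalence.from (l≡Q x) (P⊆Q px)
                           in ∈-filter⁺ P? x∈l (x∈l , px))

_≟-quad_ : ∀ {n} → DecidableEquality (Quad n)
_≟-quad_ = ≡-dec Fin._≟_ (≡-dec Fin._≟_ (≡-dec Fin._≟_ Fin._≟_))

lemma14 : ∀ (n : ℕ) (G G′ T : Graph n) →
    Connected G → Connected G′ → Subgraph G′ G →
    IsSolution G T → SpanningTree (T ∩G G′) G′ →
    ∀ (m m′ : ℕ) → MinCap G m → MinCap G′ m′ → m′ ≤ m
lemma14 n G G′ T _ _ G′⊆G (_ , k , capT , T-optimal) T′-spans m m′
        ((T₀ , T₀-spans , capT₀) , _) (_ , m′-minimal) =
  decidable-stable (m′ ≤? m) (¬¬-map bound capT′)
  where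
  capT′ : ¬ ¬ Σ ℕ λ j → CapIs G′ (T ∩G G′) j × j ≤ k
  capT′ = ¬¬-countIs-mono _≟-quad_ capT (intersectingPair-∩ G G′ T G′⊆G _)
  bound : (Σ ℕ λ j → CapIs G′ (T ∩G G′) j × j ≤ k) → m′ ≤ m
  bound (j , capj , j≤k) =
    ≤-trans (m′-minimal (T ∩G G′) j T′-spans capj)
            (≤-trans j≤k (T-optimal T₀ m T₀-spans capT₀))
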